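{- Let $G$ be a $C_{4k}$-free bipartite graph. Then (1) $\operatorname{Supp}(G)$ is the set of vertices that belong to every maximum independent set of $G$; (2) $\operatorname{Core}(G)$ is the set of vertices that belong to no maximum independent set of $G$; (3) $\operatorname{Npart}(G)$ is the set of vertices that belong to some but not all maximum independent sets of $G$.
   Context: All graphs are finite, simple and undirected. A graph is a $C_{4k}$-free bipartite graph if it is bipartite and contains no cycle whose length is a multiple of $4$. For a graph $G$, $\operatorname{Null}(G)$ is the null space of its adjacency matrix, viewed as a subspace of $\mathbb{R}^{V(G)}$; $\operatorname{Supp}(G)$ is the set of vertices $v$ with $\vec{x}_v\neq0$ for some $\vec{x}\in\operatorname{Null}(G)$; $\operatorname{Core}(G)$ is the set of vertices adjacent to some vertex of $\operatorname{Supp}(G)$; $\operatorname{Npart}(G)=V(G)\setminus(\operatorname{Supp}(G)\cup\operatorname{Core}(G))$.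
   Formalization: The null space $\operatorname{Null}(G)$ is taken over ℚ rather than ℝ, so $\operatorname{Supp}(G)$, $\operatorname{Core}(G)$ and $\operatorname{Npart}(G)$ are defined from rational null vectors. -}

module Defs where

open import Data.Nat using (ℕ; zero; suc; _≤_; _*_)
open import Data.Bool using (Bool; true; false; if_then_else_)
open import Data.Fin using (Fin; zero; suc; inject₁; fromℕ)
open import Data.Fin.Subset using (Subset; _∈_; _∉_; ∣_∣)
open import Data.Rational using (ℚ; 0ℚ; 1ℚ; _+_) renaming (_*_ to _*ℚ_)
open import Data.Product using (Σ; _×_; ∃; ∃-syntax)
open import Function.Definitions using (Injective)
open import Relation.Binary.PropositionalEquality using (_≡_; _≢_)
open import Relation.Nullary using (¬_)
open import Data.Empty using (⊥)

record Graph (n : ℕ) : Set where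
  field
    adj     : Fin n → Fin n → Bool
    adj-sym : ∀ u v → adj u v ≡ adj v u
    adj-irr : ∀ v → adj v v ≡ false
open Graph public

Adjacent : ∀ {n} → Graph n → Fin n → Fin n → Set
Adjacent G u v = adj G u v ≡ true

IsBipartite : ∀ {n} → Graph n → Set
IsBipartite {n} G = Σ (Fin n → Bool) λ col → ∀ u v → Adjacent G u v → col u ≢ col v

HasCycleOfLength : ∀ {n} → Graph n → ℕ → Set
HasCycleOfLength {n} G zero = ⊥
HasCycleOfLength {n} G (suc m) =
  3 ≤ suc m ×
  Σ (Fin (suc m) → Fin n) λ f →
    Injective _≡_ _≡_ f ×
    (∀ (i : Fin m) → Adjacent G (f (inject₁ i)) (f (suc i))) ×
    Adjacent G (f (fromℕ m)) (f zero)

IsC4kFree : ∀ {n} → Graph n → Set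
IsC4kFree G = ∀ (k : ℕ) → 1 ≤ k → ¬ HasCycleOfLength G (4 * k)

adjMatrix : ∀ {n} → Graph n → Fin n → Fin n → ℚ
adjMatrix G u v = if adj G u v then 1ℚ else 0ℚ

sumFin : ∀ {n} → (Fin n → ℚ) → ℚ
sumFin {zero} f = 0ℚ
sumFin {suc n} f = f zero + sumFin (λ i → f (suc i))

InNull : ∀ {n} → Graph n → (Fin n → ℚ) → Set
InNull G x = ∀ u → sumFin (λ v → adjMatrix G u v *ℚ x v) ≡ 0ℚ

InSupp : ∀ {n} → Graph n → Fin n → Set
InSupp {n} G v = ∃[ x ] (InNull G x × x v ≢ 0ℚ)

InCore : ∀ {n} → Graph n → Fin n → Set
InCore G v = ∃[ u ] (Adjacent G v u × InSupp G u)

InNpart : ∀ {n} → Graph n → Fin n → Set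
InNpart G v = ¬ InSupp G v × ¬ InCore G v

IsIndependent : ∀ {n} → Graph n → Subset n → Set
IsIndependent G S = ∀ u v → u ∈ S → v ∈ S → ¬ Adjacent G u v

IsMaximumIndependent : ∀ {n} → Graph n → Subset n → Set
IsMaximumIndependent G S =
  IsIndependent G S × (∀ T → IsIndependent G T → ∣ T ∣ ≤ ∣ S ∣)

-- Fix a proper 2-colouring and a maximum independent set S, and let L be the vertices of one colour
-- outside S. By Hall's theorem, either L is matched into S, or some U ⊆ L has a neighbourhood N in S
-- smaller than U, and then (S ─ N) ∪ U is an independent set at least as large as S.
-- Null vectors are rigid along such a matching: if x is nonzero at a matched vertex, the equation
-- at its mate forces a neighbour with the opposite sign, and iterating gives a closed walk through
-- matched edges on which the sign of x alternates, i.e. a cycle whose length is divisible by 4.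
-- Hence null vectors vanish outside every maximum independent set. Conversely, if the matching
-- leaves a vertex w of S of the other colour unused, the ∣L∣ equations at L in the ∣L∣ + 1 unknowns
-- at the mates and at w have a nonzero solution: a null vector that, by the same rigidity, is
-- nonzero at w. Exchanges along deficient sets provide the maximum independent sets needed in the
-- remaining cases.
module Submission where

open import Defs
open import Data.Nat using (ℕ)
open import Data.Fin using (Fin)
open import Data.Fin.Subset using (Subset; _∈_; _∉_)
open import Data.Product using (_×_; ∃-syntax)
open import Function.Bundles using (_⇔_; mk⇔)

open import Data.Bool using (Bool; true; false; not; if_then_else_)
open import Data.Bool.Properties using (not-¬; ¬-not; not-involutive)
import Data.Bool.Properties as Bool
open import Data.Empty using (⊥; ⊥-elim)
open import Data.Fin using (zero; suc; _≟_; toℕ; fromℕ<)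
open import Data.Fin.Properties
  using (any?; all?; suc-injective; toℕ-injective; toℕ<n; toℕ-inject₁; toℕ-fromℕ; toℕ-fromℕ<; injective⇒≤)
open import Data.Fin.Subset
  using (_⊆_; _⊂_; _∪_; _─_; _-_; ⁅_⁆; ∣_∣; Nonempty; Empty; outside; inside) renaming (⊥ to ∅)
open import Data.Fin.Subset.Properties
  using ( _∈?_; nonempty?; Empty-unique; ∉⊥; drop-there; x∈⁅x⁆; x∈⁅y⁆⇒x≡y; x∈p∪q⁺; x∈p∪q⁻; x∈p∩q⁺
        ; x∈p∧x≢y⇒x∈p-y; x∈p∧x∉q⇒x∈p─q; p─q⊆p; p─⊥≡p; ⊆-⊂-trans; x∈p⇒p-x⊂p; p∩q≢∅⇒p─q⊂p
        ; p⊆q⇒∣p∣≤∣q∣; ∣p∣≤∣x∷p∣; ∣p∣≤∣p∪q∣; ∣⊥∣≡0; ∣⁅x⁆∣≡1; x∈p⇒∣p-x∣<∣p∣ )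
open import Data.Fin.Subset.Induction using (⊂-wellFounded)
open import Data.Product using (Σ; _,_; ∃; ∃₂; proj₁; proj₂)
open import Data.Rational as ℚ using (ℚ; 0ℚ)
open import Data.Sum using (_⊎_; inj₁; inj₂; [_,_]; swap)
open import Data.Vec using ([]; _∷_; here; there)
open import Function using (_∘_; id; case_of_)
open import Induction.WellFounded using (Acc; acc)
open import Level using (Level)
open import Relation.Binary.Core using (REL)
open import Relation.Binary.Definitions using () renaming (Decidable to Decidable₂)
open import Relation.Binary.PropositionalEquality
  using (_≡_; _≢_; refl; sym; trans; cong; cong₂; subst; subst₂)
open import Relation.Nullary using (Dec; yes; no; does; ¬_; ¬?; contradiction; _×-dec_; _→-dec_)
open import Relation.Nullary.Decidable using (dec-true; dec-false; decidable-stable)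
open import Relation.Unary using (Pred; Decidable)

private
  variable
    ℓ : Level
    m n p q : ℕ

-- ℕ and ℚ use the same operator names: ℕ arithmetic is opened inside FiniteSets and, after
-- RationalVectors (which opens ℚ arithmetic), once more at top level.
module FiniteSets where

  open import Data.Nat using (zero; suc; _+_; _≤_; _<_; z≤n; s≤s)
  open import Data.Nat.Properties
    using (≤-trans; ≤-reflexive; ≤-refl; ≤-total; ≤-pred; m≤n⇒m≤1+n; >⇒≢; +-suc; +-comm; +-monoʳ-≤
          ; module ≤-Reasoning)

  select : {P : Pred (Fin n) ℓ} → Decidable P → Subset n
  select {zero}  P? = []
  select {suc n} P? = does (P? zero) ∷ select (P? ∘ suc)

  ∈-select⁺ : {P : Pred (Fin n) ℓ} (P? : Decidable P) {x : Fin n} → P x → x ∈ select P?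
  ∈-select⁺ P? {zero} px with P? zero
  ... | yes _   = here
  ... | no  ¬px = contradiction px ¬px
  ∈-select⁺ P? {suc x} px = there (∈-select⁺ (P? ∘ suc) px)

  ∈-select⁻ : {P : Pred (Fin n) ℓ} (P? : Decidable P) {x : Fin n} → x ∈ select P? → P x
  ∈-select⁻ P? {zero} x∈ with P? zero | x∈
  ... | yes px | here = px
  ∈-select⁻ P? {suc x} (there x∈) = ∈-select⁻ (P? ∘ suc) x∈

  ∪-⊆ : {p q r : Subset n} → p ⊆ r → q ⊆ r → p ∪ q ⊆ r
  ∪-⊆ {p = p} {q} p⊆r q⊆r x∈p∪q with x∈p∪q⁻ p q x∈p∪q
  ... | inj₁ x∈p = p⊆r x∈p
  ... | inj₂ x∈q = q⊆r x∈q

  x∈p─q⇒x∉q : (p q : Subset n) {x : Fin n} → x ∈ p ─ q → x ∉ q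
  x∈p─q⇒x∉q (inside ∷ p)  (inside ∷ q) ()         here
  x∈p─q⇒x∉q (outside ∷ p) (inside ∷ q) ()         here
  x∈p─q⇒x∉q (_ ∷ p)       (_ ∷ q)      (there x∈) (there x∈q) = x∈p─q⇒x∉q p q x∈ x∈q

  Disjoint : Subset n → Subset n → Set
  Disjoint p q = ∀ {x} → x ∈ p → x ∉ q

  Disjoint-tail : {s t : Bool} {p q : Subset n} → Disjoint (s ∷ p) (t ∷ q) → Disjoint p q
  Disjoint-tail disjoint x∈p x∈q = disjoint (there x∈p) (there x∈q)

  ∣p∪q∣≤∣p∣+∣q∣ : (p q : Subset n) → ∣ p ∪ q ∣ ≤ ∣ p ∣ + ∣ q ∣
  ∣p∪q∣≤∣p∣+∣q∣ []            []            = z≤n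
  ∣p∪q∣≤∣p∣+∣q∣ (inside ∷ p)  (s ∷ q)       =
    s≤s (≤-trans (∣p∪q∣≤∣p∣+∣q∣ p q) (+-monoʳ-≤ ∣ p ∣ (∣p∣≤∣x∷p∣ s q)))
  ∣p∪q∣≤∣p∣+∣q∣ (outside ∷ p) (inside ∷ q)  =
    ≤-trans (s≤s (∣p∪q∣≤∣p∣+∣q∣ p q)) (≤-reflexive (sym (+-suc ∣ p ∣ ∣ q ∣)))
  ∣p∪q∣≤∣p∣+∣q∣ (outside ∷ p) (outside ∷ q) = ∣p∪q∣≤∣p∣+∣q∣ p q

  ∣p∪q∣≡∣p∣+∣q∣ : (p q : Subset n) → Disjoint p q → ∣ p ∪ q ∣ ≡ ∣ p ∣ + ∣ q ∣
  ∣p∪q∣≡∣p∣+∣q∣ []            []            _        = refl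
  ∣p∪q∣≡∣p∣+∣q∣ (inside ∷ p)  (inside ∷ q)  disjoint = contradiction here (disjoint here)
  ∣p∪q∣≡∣p∣+∣q∣ (inside ∷ p)  (outside ∷ q) disjoint = cong suc (∣p∪q∣≡∣p∣+∣q∣ p q (Disjoint-tail disjoint))
  ∣p∪q∣≡∣p∣+∣q∣ (outside ∷ p) (inside ∷ q)  disjoint =
    trans (cong suc (∣p∪q∣≡∣p∣+∣q∣ p q (Disjoint-tail disjoint))) (sym (+-suc ∣ p ∣ ∣ q ∣))
  ∣p∪q∣≡∣p∣+∣q∣ (outside ∷ p) (outside ∷ q) disjoint = ∣p∪q∣≡∣p∣+∣q∣ p q (Disjoint-tail disjoint)

  x∉p⇒∣p∪⁅x⁆∣≡1+∣p∣ : (p : Subset n) {x : Fin n} → x ∉ p → ∣ p ∪ ⁅ x ⁆ ∣ ≡ suc ∣ p ∣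
  x∉p⇒∣p∪⁅x⁆∣≡1+∣p∣ p {x} x∉p = begin-equality
    ∣ p ∪ ⁅ x ⁆ ∣     ≡⟨ ∣p∪q∣≡∣p∣+∣q∣ p ⁅ x ⁆ disjoint ⟩
    ∣ p ∣ + ∣ ⁅ x ⁆ ∣ ≡⟨ cong (∣ p ∣ +_) (∣⁅x⁆∣≡1 x) ⟩
    ∣ p ∣ + 1         ≡⟨ +-comm ∣ p ∣ 1 ⟩
    suc ∣ p ∣         ∎
    where
    open ≤-Reasoning
    disjoint : Disjoint p ⁅ x ⁆
    disjoint y∈p y∈⁅x⁆ = x∉p (subst (_∈ p) (x∈⁅y⁆⇒x≡y x y∈⁅x⁆) y∈p)

  ∣p∣≤1+∣p-x∣ : (p : Subset n) (x : Fin n) → ∣ p ∣ ≤ suc ∣ p - x ∣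
  ∣p∣≤1+∣p-x∣ (inside ∷ p)  zero    = s≤s (≤-reflexive (cong ∣_∣ (sym (p─⊥≡p p))))
  ∣p∣≤1+∣p-x∣ (outside ∷ p) zero    = m≤n⇒m≤1+n (≤-reflexive (cong ∣_∣ (sym (p─⊥≡p p))))
  ∣p∣≤1+∣p-x∣ (inside ∷ p)  (suc x) = s≤s (∣p∣≤1+∣p-x∣ p x)
  ∣p∣≤1+∣p-x∣ (outside ∷ p) (suc x) = ∣p∣≤1+∣p-x∣ p x

  ∣p∣≤∣p─q∣+∣q∣ : (p q : Subset n) → ∣ p ∣ ≤ ∣ p ─ q ∣ + ∣ q ∣
  ∣p∣≤∣p─q∣+∣q∣ p q = ≤-trans (p⊆q⇒∣p∣≤∣q∣ p⊆p─q∪q) (∣p∪q∣≤∣p∣+∣q∣ (p ─ q) q)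
    where
    p⊆p─q∪q : p ⊆ (p ─ q) ∪ q
    p⊆p─q∪q {x} x∈p with x ∈? q
    ... | yes x∈q = x∈p∪q⁺ (inj₂ x∈q)
    ... | no  x∉q = x∈p∪q⁺ (inj₁ (x∈p∧x∉q⇒x∈p─q x∈p x∉q))

  Empty⇒∣p∣≡0 : (p : Subset n) → Empty p → ∣ p ∣ ≡ 0
  Empty⇒∣p∣≡0 {n} p ∅ = trans (cong ∣_∣ (Empty-unique ∅)) (∣⊥∣≡0 n)

  ∣p∣>0⇒Nonempty : (p : Subset n) → 0 < ∣ p ∣ → Nonempty p
  ∣p∣>0⇒Nonempty p 0<∣p∣ with nonempty? p
  ... | yes ne = ne
  ... | no  ∅  = contradiction (Empty⇒∣p∣≡0 p ∅) (>⇒≢ 0<∣p∣)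

  InjectiveOn : {A : Set ℓ} → Subset p → (Fin p → A) → Set ℓ
  InjectiveOn L f = ∀ {i j} → i ∈ L → j ∈ L → f i ≡ f j → i ≡ j

  injectiveOn-tail : {A : Set ℓ} {s : Bool} {L : Subset p} {f : Fin (suc p) → A} →
                     InjectiveOn (s ∷ L) f → InjectiveOn L (f ∘ suc)
  injectiveOn-tail injective i∈L j∈L eq = suc-injective (injective (there i∈L) (there j∈L) eq)

  module _ {R : REL (Fin p) (Fin q) ℓ} (R? : Decidable₂ R) where

    neighbourhood : Subset p → Subset q
    neighbourhood U = select λ y → any? λ i → i ∈? U ×-dec R? i y

    ∈-neighbourhood⁺ : {U : Subset p} {i : Fin p} {y : Fin q} → i ∈ U → R i y → y ∈ neighbourhood U
    ∈-neighbourhood⁺ i∈U Riy = ∈-select⁺ _ (_ , i∈U , Riy)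

    ∈-neighbourhood⁻ : {U : Subset p} {y : Fin q} → y ∈ neighbourhood U → ∃ λ i → i ∈ U × R i y
    ∈-neighbourhood⁻ = ∈-select⁻ _

  image : (Fin p → Fin q) → Subset p → Subset q
  image f = neighbourhood λ i y → f i ≟ y

  module _ (f : Fin p → Fin q) {L : Subset p} where

    ∈-image⁺ : {i : Fin p} → i ∈ L → f i ∈ image f L
    ∈-image⁺ i∈L = ∈-neighbourhood⁺ _ i∈L refl

    ∈-image⁻ : {y : Fin q} → y ∈ image f L → ∃ λ i → i ∈ L × f i ≡ y
    ∈-image⁻ = ∈-neighbourhood⁻ _

  image-tail⊆ : (f : Fin (suc p) → Fin q) (s : Bool) (L : Subset p) → image (f ∘ suc) L ⊆ image f (s ∷ L)
  image-tail⊆ f s L y∈ with ∈-image⁻ (f ∘ suc) y∈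
  ... | i , i∈L , refl = ∈-image⁺ f (there i∈L)

  ∣p∣≤∣image∣ : (f : Fin p → Fin q) (L : Subset p) → InjectiveOn L f → ∣ L ∣ ≤ ∣ image f L ∣
  ∣p∣≤∣image∣ f []            _         = z≤n
  ∣p∣≤∣image∣ f (outside ∷ L) injective =
    ≤-trans (∣p∣≤∣image∣ (f ∘ suc) L (injectiveOn-tail injective)) (p⊆q⇒∣p∣≤∣q∣ (image-tail⊆ f outside L))
  ∣p∣≤∣image∣ f (inside ∷ L) injective = begin
    suc ∣ L ∣                          ≤⟨ s≤s (∣p∣≤∣image∣ (f ∘ suc) L (injectiveOn-tail injective)) ⟩
    suc ∣ image (f ∘ suc) L ∣          ≡⟨ x∉p⇒∣p∪⁅x⁆∣≡1+∣p∣ (image (f ∘ suc) L) f₀-new ⟨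
    ∣ image (f ∘ suc) L ∪ ⁅ f zero ⁆ ∣ ≤⟨ p⊆q⇒∣p∣≤∣q∣ (∪-⊆ (image-tail⊆ f inside L) ⁅f₀⁆⊆) ⟩
    ∣ image f (inside ∷ L) ∣           ∎
    where
    open ≤-Reasoning
    f₀-new : f zero ∉ image (f ∘ suc) L
    f₀-new f₀∈ with ∈-image⁻ (f ∘ suc) f₀∈
    ... | i , i∈L , eq with injective (there i∈L) here eq
    ... | ()
    ⁅f₀⁆⊆ : ⁅ f zero ⁆ ⊆ image f (inside ∷ L)
    ⁅f₀⁆⊆ y∈⁅f₀⁆ rewrite x∈⁅y⁆⇒x≡y _ y∈⁅f₀⁆ = ∈-image⁺ f here

  argmax : (f : Subset n → ℕ) → ∃ λ S → ∀ T → f T ≤ f S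
  argmax {zero}  f = [] , λ { [] → ≤-refl }
  argmax {suc n} f with argmax (f ∘ (inside ∷_)) | argmax (f ∘ (outside ∷_))
  ... | S₁ , max₁ | S₀ , max₀ with ≤-total (f (inside ∷ S₁)) (f (outside ∷ S₀))
  ...   | inj₁ f₁≤f₀ = outside ∷ S₀ , λ { (inside ∷ T) → ≤-trans (max₁ T) f₁≤f₀ ; (outside ∷ T) → max₀ T }
  ...   | inj₂ f₀≤f₁ = inside ∷ S₁ , λ { (inside ∷ T) → max₁ T ; (outside ∷ T) → ≤-trans (max₀ T) f₀≤f₁ }

  module _ {P : Pred (Subset n) ℓ} (P? : Decidable P) where

    private
      score : Subset n → ℕ
      score S = if does (P? S) then suc ∣ S ∣ else 0

      score-yes : ∀ {S} → P S → score S ≡ suc ∣ S ∣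
      score-yes {S} PS = cong (λ b → if b then suc ∣ S ∣ else 0) (dec-true (P? S) PS)

      score-no : ∀ {S} → ¬ P S → score S ≡ 0
      score-no {S} ¬PS = cong (λ b → if b then suc ∣ S ∣ else 0) (dec-false (P? S) ¬PS)

    largest : {S₀ : Subset n} → P S₀ → ∃ λ S → P S × ∀ T → P T → ∣ T ∣ ≤ ∣ S ∣
    largest {S₀} PS₀ with argmax score
    ... | S , max = S , PS , λ T PT → ≤-pred (subst₂ _≤_ (score-yes PT) (score-yes PS) (max T))
      where
      PS : P S
      PS = decidable-stable (P? S) λ ¬PS →
        contradiction (subst₂ _≤_ (score-yes PS₀) (score-no ¬PS) (max S₀)) λ ()

open FiniteSets

module RationalVectors where

  open import Data.Nat as ℕ using (zero; suc)
  import Data.Nat.Properties as ℕ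
  open import Data.Rational using (1ℚ; _+_; _*_; -_; 1/_; _<_; _≤_; _<?_; ≢-nonZero; positive; negative; nonPositive)
  open import Data.Rational.Properties
    using ( +-identityˡ; +-identityʳ; *-zeroˡ; *-zeroʳ; *-identityˡ; *-identityʳ; *-inverseʳ; *-distribˡ-+
          ; ≤-refl; ≤-trans; ≤-reflexive; <-≤-trans; <-irrefl; <-asym; <-cmp; ≮⇒≥; +-mono-≤; +-monoʳ-≤; +-monoˡ-≤
          ; positive⁻¹; nonNegative⁻¹; pos*pos⇒pos; neg*neg⇒pos; nonPos*nonPos⇒nonPos )
  open import Data.Rational.Solver using (module +-*-Solver)
  open import Relation.Binary.Definitions using (tri<; tri≈; tri>)
  open import Relation.Binary.PropositionalEquality using (module ≡-Reasoning)
  open +-*-Solver using (solve; _:+_; _:*_; :-_; _:=_; con)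

  sumFin-cong : {f g : Fin n → ℚ} → (∀ i → f i ≡ g i) → sumFin f ≡ sumFin g
  sumFin-cong {zero}  f≗g = refl
  sumFin-cong {suc n} f≗g = cong₂ _+_ (f≗g zero) (sumFin-cong (f≗g ∘ suc))

  sumFin-zero : {f : Fin n → ℚ} → (∀ i → f i ≡ 0ℚ) → sumFin f ≡ 0ℚ
  sumFin-zero {zero}  f≗0 = refl
  sumFin-zero {suc n} f≗0 = trans (cong₂ _+_ (f≗0 zero) (sumFin-zero (f≗0 ∘ suc))) (+-identityˡ 0ℚ)

  sumFin-+ : (f g : Fin n → ℚ) → sumFin (λ i → f i + g i) ≡ sumFin f + sumFin g
  sumFin-+ {zero}  f g = refl
  sumFin-+ {suc n} f g = trans (cong (f zero + g zero +_) (sumFin-+ (f ∘ suc) (g ∘ suc)))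
    (solve 4 (λ a b c d → (a :+ b) :+ (c :+ d) := (a :+ c) :+ (b :+ d)) refl
           (f zero) (g zero) (sumFin (f ∘ suc)) (sumFin (g ∘ suc)))

  sumFin-* : (c : ℚ) (f : Fin n → ℚ) → sumFin (λ i → c * f i) ≡ c * sumFin f
  sumFin-* {zero}  c f = sym (*-zeroʳ c)
  sumFin-* {suc n} c f = trans (cong (c * f zero +_) (sumFin-* c (f ∘ suc))) (sym (*-distribˡ-+ c (f zero) _))

  sumFin-nonneg : (f : Fin n → ℚ) → (∀ i → 0ℚ ≤ f i) → 0ℚ ≤ sumFin f
  sumFin-nonneg {zero}  f f≥0 = ≤-refl
  sumFin-nonneg {suc n} f f≥0 =
    ≤-trans (≤-reflexive (sym (+-identityˡ 0ℚ))) (+-mono-≤ (f≥0 zero) (sumFin-nonneg (f ∘ suc) (f≥0 ∘ suc)))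

  sumFin-pos : (f : Fin n → ℚ) → (∀ i → 0ℚ ≤ f i) → ∀ j → 0ℚ < f j → 0ℚ < sumFin f
  sumFin-pos f f≥0 zero    0<f₀ = <-≤-trans 0<f₀ (≤-trans (≤-reflexive (sym (+-identityʳ (f zero))))
    (+-monoʳ-≤ (f zero) (sumFin-nonneg (f ∘ suc) (f≥0 ∘ suc))))
  sumFin-pos f f≥0 (suc j) 0<fⱼ = <-≤-trans (sumFin-pos (f ∘ suc) (f≥0 ∘ suc) j 0<fⱼ)
    (≤-trans (≤-reflexive (sym (+-identityˡ _))) (+-monoˡ-≤ (sumFin (f ∘ suc)) (f≥0 zero)))

  sumFin≡0⇒negative : (f : Fin n → ℚ) → sumFin f ≡ 0ℚ → ∀ j → 0ℚ < f j → ∃ λ i → f i < 0ℚ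
  sumFin≡0⇒negative f Σf≡0 j 0<fⱼ with any? (λ i → f i <? 0ℚ)
  ... | yes negative-term = negative-term
  ... | no  none          = contradiction (sumFin-pos f (λ i → ≮⇒≥ λ fᵢ<0 → none (i , fᵢ<0)) j 0<fⱼ)
                                          (<-irrefl (sym Σf≡0))

  infix 7 _·_
  _·_ : (Fin n → ℚ) → (Fin n → ℚ) → ℚ
  f · g = sumFin λ j → f j * g j

  ·-linearˡ : (f g h : Fin n → ℚ) (c : ℚ) → (λ j → f j + c * g j) · h ≡ f · h + c * (g · h)
  ·-linearˡ f g h c = begin
    sumFin (λ j → (f j + c * g j) * h j)       ≡⟨ sumFin-cong (λ j → distribute (f j) (g j) (h j)) ⟩
    sumFin (λ j → f j * h j + c * (g j * h j)) ≡⟨ sumFin-+ (λ j → f j * h j) (λ j → c * (g j * h j)) ⟩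
    f · h + sumFin (λ j → c * (g j * h j))     ≡⟨ cong (f · h +_) (sumFin-* c (λ j → g j * h j)) ⟩
    f · h + c * (g · h)                        ∎
    where
    open ≡-Reasoning
    distribute : ∀ a b d → (a + c * b) * d ≡ a * d + c * (b * d)
    distribute a b d = solve 4 (λ a b d c → (a :+ c :* b) :* d := a :* d :+ c :* (b :* d)) refl a b d c

  ·-linearʳ : (f g h : Fin n → ℚ) (c : ℚ) → f · (λ j → g j + c * h j) ≡ f · g + c * (f · h)
  ·-linearʳ f g h c = begin
    sumFin (λ j → f j * (g j + c * h j))       ≡⟨ sumFin-cong (λ j → distribute (f j) (g j) (h j)) ⟩
    sumFin (λ j → f j * g j + c * (f j * h j)) ≡⟨ sumFin-+ (λ j → f j * g j) (λ j → c * (f j * h j)) ⟩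
    f · g + sumFin (λ j → c * (f j * h j))     ≡⟨ cong (f · g +_) (sumFin-* c (λ j → f j * h j)) ⟩
    f · g + c * (f · h)                        ∎
    where
    open ≡-Reasoning
    distribute : ∀ a b d → a * (b + c * d) ≡ a * b + c * (a * d)
    distribute a b d = solve 4 (λ a b d c → a :* (b :+ c :* d) := a :* b :+ c :* (a :* d)) refl a b d c

  ·-zero : (f g : Fin n → ℚ) → (∀ j → f j ≡ 0ℚ ⊎ g j ≡ 0ℚ) → f · g ≡ 0ℚ
  ·-zero f g f⊎g≡0 = sumFin-zero λ j → [ (λ fⱼ≡0 → trans (cong (_* g j) fⱼ≡0) (*-zeroˡ (g j)))
                                       , (λ gⱼ≡0 → trans (cong (f j *_) gⱼ≡0) (*-zeroʳ (f j)))
                                       ] (f⊎g≡0 j)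

  unit : Fin n → Fin n → ℚ
  unit i j = if does (j ≟ i) then 1ℚ else 0ℚ

  unit-on : (i : Fin n) → unit i i ≡ 1ℚ
  unit-on i with i ≟ i
  ... | yes _   = refl
  ... | no  i≢i = contradiction refl i≢i

  unit-off : {i j : Fin n} → j ≢ i → unit i j ≡ 0ℚ
  unit-off {i = i} {j} j≢i with j ≟ i
  ... | yes j≡i = contradiction j≡i j≢i
  ... | no  _   = refl

  ·-unit : (f : Fin n → ℚ) (i : Fin n) → f · unit i ≡ f i
  ·-unit {suc n} f zero    =
    trans (cong₂ _+_ (*-identityʳ (f zero)) (sumFin-zero (λ j → *-zeroʳ (f (suc j))))) (+-identityʳ (f zero))
  ·-unit {suc n} f (suc i) = trans (cong₂ _+_ (*-zeroʳ (f zero)) (·-unit (f ∘ suc) i)) (+-identityˡ (f (suc i)))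

  sign : ℚ → Bool
  sign x = does (0ℚ <? x)

  sign-flip : (x y : ℚ) → x * y < 0ℚ → sign y ≡ not (sign x)
  sign-flip x y xy<0 = flip (0ℚ <? x) (0ℚ <? y)
    where
    flip : (0<x? : Dec (0ℚ < x)) (0<y? : Dec (0ℚ < y)) → does 0<y? ≡ not (does 0<x?)
    flip (yes 0<x) (yes 0<y) =
      contradiction (positive⁻¹ (x * y) {{pos*pos⇒pos x {{positive 0<x}} y {{positive 0<y}}}}) (<-asym xy<0)
    flip (yes _)   (no  _)   = refl
    flip (no  _)   (yes _)   = refl
    flip (no  x≯0) (no  y≯0) = contradiction (<-≤-trans xy<0 (nonNegative⁻¹ (x * y)
      {{nonPos*nonPos⇒nonPos x {{nonPositive (≮⇒≥ x≯0)}} y {{nonPositive (≮⇒≥ y≯0)}}}})) (<-irrefl refl)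

  square-pos : (x : ℚ) → x ≢ 0ℚ → 0ℚ < x * x
  square-pos x x≢0 with <-cmp x 0ℚ
  ... | tri< x<0 _ _ = positive⁻¹ (x * x) {{neg*neg⇒pos x {{negative x<0}} x {{negative x<0}}}}
  ... | tri≈ _ x≡0 _ = contradiction x≡0 x≢0
  ... | tri> _ _ 0<x = positive⁻¹ (x * x) {{pos*pos⇒pos x {{positive 0<x}} x {{positive 0<x}}}}

  -- Multiplying the equation at u by x w, the term at w is positive, so another term is negative.
  opposite-sign-neighbour : (G : Graph n) (x : Fin n → ℚ) {u w : Fin n} →
    adjMatrix G u · x ≡ 0ℚ → Adjacent G u w → x w ≢ 0ℚ →
    ∃ λ w′ → Adjacent G u w′ × x w′ ≢ 0ℚ × sign (x w′) ≡ not (sign (x w))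
  opposite-sign-neighbour G x {u} {w} Ax≡0 u~w xw≢0 with sumFin≡0⇒negative term Σterm≡0 w term-w>0
    where
    term : Fin _ → ℚ
    term j = x w * (adjMatrix G u j * x j)
    Σterm≡0 : sumFin term ≡ 0ℚ
    Σterm≡0 = trans (sumFin-* (x w) (λ j → adjMatrix G u j * x j)) (trans (cong (x w *_) Ax≡0) (*-zeroʳ (x w)))
    term-w>0 : 0ℚ < term w
    term-w>0 = subst (0ℚ <_) (cong (x w *_) (sym (trans (cong (λ b → (if b then 1ℚ else 0ℚ) * x w) u~w)
                                                         (*-identityˡ (x w)))))
                     (square-pos (x w) xw≢0)
  ... | j , termⱼ<0 with adj G u j in u~j
  ...   | false = contradiction (subst (_< 0ℚ) (trans (cong (x w *_) (*-zeroˡ (x j))) (*-zeroʳ (x w))) termⱼ<0)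
                              (<-irrefl refl)
  ...   | true  = j , u~j , xⱼ≢0 , sign-flip (x w) (x j) product<0
    where
    product<0 : x w * x j < 0ℚ
    product<0 = subst (_< 0ℚ) (cong (x w *_) (*-identityˡ (x j))) termⱼ<0
    xⱼ≢0 : x j ≢ 0ℚ
    xⱼ≢0 xⱼ≡0 = <-irrefl refl (subst (_< 0ℚ) (trans (cong (x w *_) xⱼ≡0) (*-zeroʳ (x w))) product<0)

  record NonzeroSolution (a : Fin m → Fin n → ℚ) (Q : Subset m) (U : Subset n) : Set where
    field
      vector    : Fin n → ℚ
      supported : ∀ {j} → j ∉ U → vector j ≡ 0ℚ
      nonzero   : ∃ λ j → vector j ≢ 0ℚ
      solves    : ∀ {r} → r ∈ Q → a r · vector ≡ 0ℚ

  eliminate : (a : Fin m → Fin n → ℚ) (q : Fin m) (j₀ : Fin n) (μ : ℚ) → Fin m → Fin n → ℚ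
  eliminate a q j₀ μ r j = a r j + - (a r j₀ * μ) * a q j

  eliminate-pivot-row : (a : Fin m → Fin n → ℚ) {q : Fin m} {j₀ : Fin n} {μ : ℚ} → a q j₀ * μ ≡ 1ℚ →
                        ∀ j → eliminate a q j₀ μ q j ≡ 0ℚ
  eliminate-pivot-row a {q} pivot*μ≡1 j = trans (cong (λ e → a q j + - e * a q j) pivot*μ≡1)
    (solve 1 (λ x → x :+ :- con 1ℚ :* x := con 0ℚ) refl (a q j))

  back-substitute : (a : Fin m → Fin n → ℚ) (q : Fin m) (j₀ : Fin n) (μ : ℚ) → (Fin n → ℚ) → Fin n → ℚ
  back-substitute a q j₀ μ z j = z j + - (μ * (a q · z)) * unit j₀ j

  ·-back-substitute : (a : Fin m → Fin n → ℚ) (q : Fin m) (j₀ : Fin n) (μ : ℚ) (z : Fin n → ℚ) (r : Fin m) →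
                      a r · back-substitute a q j₀ μ z ≡ eliminate a q j₀ μ r · z
  ·-back-substitute a q j₀ μ z r = begin
    a r · back-substitute a q j₀ μ z       ≡⟨ ·-linearʳ (a r) z (unit j₀) t ⟩
    a r · z + t * (a r · unit j₀)          ≡⟨ cong (λ e → a r · z + t * e) (·-unit (a r) j₀) ⟩
    a r · z + t * a r j₀                   ≡⟨ cong (a r · z +_) rearrange ⟩
    a r · z + - (a r j₀ * μ) * (a q · z)   ≡⟨ ·-linearˡ (a r) (a q) z (- (a r j₀ * μ)) ⟨
    eliminate a q j₀ μ r · z               ∎
    where
    open ≡-Reasoning
    t = - (μ * (a q · z))
    rearrange : t * a r j₀ ≡ - (a r j₀ * μ) * (a q · z)
    rearrange = solve 3 (λ μ s c → :- (μ :* s) :* c := :- (c :* μ) :* s) refl μ (a q · z) (a r j₀)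

  module _ {a : Fin m → Fin n → ℚ} {Q : Subset m} {U : Subset n} where

    unit-solution : {j₀ : Fin n} → j₀ ∈ U → Empty Q → NonzeroSolution a Q U
    unit-solution {j₀} j₀∈U ∅ = record
      { vector    = unit j₀
      ; supported = λ {j} j∉U → unit-off {i = j₀} {j} λ { refl → j∉U j₀∈U }
      ; nonzero   = j₀ , λ unit≡0 → contradiction (trans (sym (unit-on j₀)) unit≡0) λ ()
      ; solves    = λ r∈Q → contradiction (_ , r∈Q) ∅
      }

    drop-row : {q : Fin m} → (∀ {j} → j ∈ U → a q j ≡ 0ℚ) →
               NonzeroSolution a (Q - q) U → NonzeroSolution a Q U
    drop-row {q} row-vanishes S = record
      { vector = vector ; supported = supported ; nonzero = nonzero ; solves = solves′ }
      where
      open NonzeroSolution S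
      solves′ : ∀ {r} → r ∈ Q → a r · vector ≡ 0ℚ
      solves′ {r} r∈Q with r ≟ q
      ... | no  r≢q  = solves (x∈p∧x≢y⇒x∈p-y r∈Q r≢q)
      ... | yes refl = ·-zero (a q) vector λ j → case j ∈? U of λ where
        (yes j∈U) → inj₁ (row-vanishes j∈U)
        (no  j∉U) → inj₂ (supported j∉U)

    pivot-step : {q : Fin m} {j₀ : Fin n} {μ : ℚ} → a q j₀ * μ ≡ 1ℚ → j₀ ∈ U →
                 NonzeroSolution (eliminate a q j₀ μ) (Q - q) (U - j₀) → NonzeroSolution a Q U
    pivot-step {q} {j₀} {μ} pivot*μ≡1 j₀∈U S = record
      { vector = z ; supported = supported ; nonzero = nonzero ; solves = solves }
      where
      module S = NonzeroSolution S
      z = back-substitute a q j₀ μ S.vector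
      t = - (μ * (a q · S.vector))

      z-off : ∀ {j} → j ≢ j₀ → z j ≡ S.vector j
      z-off {j} j≢j₀ = trans (cong (λ e → S.vector j + t * e) (unit-off j≢j₀))
                             (trans (cong (S.vector j +_) (*-zeroʳ t)) (+-identityʳ (S.vector j)))

      supported : ∀ {j} → j ∉ U → z j ≡ 0ℚ
      supported j∉U = trans (z-off λ { refl → j∉U j₀∈U }) (S.supported (j∉U ∘ p─q⊆p U ⁅ j₀ ⁆))

      nonzero : ∃ λ j → z j ≢ 0ℚ
      nonzero with S.nonzero
      ... | j , zⱼ≢0 = j , λ zⱼ≡0 → zⱼ≢0 (trans (sym (z-off j≢j₀)) zⱼ≡0)
        where
        j≢j₀ : j ≢ j₀
        j≢j₀ refl = zⱼ≢0 (S.supported λ j₀∈U-j₀ → x∈p─q⇒x∉q U ⁅ j₀ ⁆ j₀∈U-j₀ (x∈⁅x⁆ j₀))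

      solves : ∀ {r} → r ∈ Q → a r · z ≡ 0ℚ
      solves {r} r∈Q with r ≟ q
      ... | yes refl = trans (·-back-substitute a q j₀ μ S.vector q)
                             (·-zero _ S.vector (inj₁ ∘ eliminate-pivot-row a pivot*μ≡1))
      ... | no  r≢q  = trans (·-back-substitute a q j₀ μ S.vector r) (S.solves (x∈p∧x≢y⇒x∈p-y r∈Q r≢q))

  nonzero-solution-acc : {Q : Subset m} → Acc _⊂_ Q → (a : Fin m → Fin n → ℚ) (U : Subset n) →
                         ∣ Q ∣ ℕ.< ∣ U ∣ → NonzeroSolution a Q U
  nonzero-solution-acc {Q = Q} (acc smaller) a U ∣Q∣<∣U∣ with nonempty? Q
  ... | no  ∅ = unit-solution (proj₂ (∣p∣>0⇒Nonempty U (ℕ.≤-<-trans ℕ.z≤n ∣Q∣<∣U∣))) ∅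
  ... | yes (q , q∈Q) with any? (λ j → j ∈? U ×-dec ¬? (a q j ℚ.≟ 0ℚ))
  ...   | no  no-pivot = drop-row row-vanishes
    (nonzero-solution-acc (smaller (x∈p⇒p-x⊂p q∈Q)) a U (ℕ.<-trans (x∈p⇒∣p-x∣<∣p∣ q∈Q) ∣Q∣<∣U∣))
    where
    row-vanishes : ∀ {j} → j ∈ U → a q j ≡ 0ℚ
    row-vanishes {j} j∈U with a q j ℚ.≟ 0ℚ
    ... | yes aqj≡0 = aqj≡0
    ... | no  aqj≢0 = contradiction (j , j∈U , aqj≢0) no-pivot
  ...   | yes (j₀ , j₀∈U , pivot≢0) = pivot-step (*-inverseʳ (a q j₀) {{≢-nonZero pivot≢0}}) j₀∈U
    (nonzero-solution-acc (smaller (x∈p⇒p-x⊂p q∈Q)) (eliminate a q j₀ (1/_ (a q j₀) {{≢-nonZero pivot≢0}}))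
                          (U - j₀) smaller-system)
    where
    smaller-system : ∣ Q - q ∣ ℕ.< ∣ U - j₀ ∣
    smaller-system = ℕ.≤-pred (ℕ.≤-trans (ℕ.s≤s (x∈p⇒∣p-x∣<∣p∣ q∈Q)) (ℕ.≤-trans ∣Q∣<∣U∣ (∣p∣≤1+∣p-x∣ U j₀)))

  nonzero-solution : (a : Fin m → Fin n → ℚ) (Q : Subset m) (U : Subset n) →
                     ∣ Q ∣ ℕ.< ∣ U ∣ → NonzeroSolution a Q U
  nonzero-solution a Q = nonzero-solution-acc (⊂-wellFounded Q) a

open RationalVectors

open import Data.Nat using (zero; suc; _+_; _*_; _∸_; _≤_; _<_; z≤n; s≤s)
open import Data.Nat.Properties
  using ( ≤-refl; ≤-trans; ≤-<-trans; ≤-pred; <⇒≤; <⇒≱; ≮⇒≥; <-irrefl; _<?_; n≤1+n; n<1+n; m<n⇒m<1+n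
        ; m<1+n⇒m<n∨m≡n; m<n⇒0<n∸m; m+[n∸m]≡n; +-identityʳ; +-suc; +-comm; +-cancelˡ-≡; +-cancelʳ-≤
        ; +-mono-≤; +-monoˡ-≤; +-monoʳ-≤; +-monoʳ-<; +-mono-≤-<; module ≤-Reasoning )
open import Data.Nat.Solver using (module +-*-Solver)
open +-*-Solver using (solve; _:+_; _:*_; _:=_; con)

record Matching (R : REL (Fin p) (Fin q) ℓ) (L : Subset p) : Set ℓ where
  field
    mate           : Fin p → Fin q
    mate-related   : ∀ {i} → i ∈ L → R i (mate i)
    mate-injective : InjectiveOn L mate

matching-map : {R R′ : REL (Fin p) (Fin q) ℓ} {L : Subset p} →
               (∀ {i y} → R i y → R′ i y) → Matching R L → Matching R′ L
matching-map R⇒R′ M = record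
  { mate = mate ; mate-related = R⇒R′ ∘ mate-related ; mate-injective = mate-injective }
  where open Matching M

matching-tail : {R : REL (Fin (suc p)) (Fin q) ℓ} {s : Bool} {L : Subset p} →
                Matching R (s ∷ L) → Matching (λ i → R (suc i)) L
matching-tail M = record
  { mate = mate ∘ suc ; mate-related = mate-related ∘ there ; mate-injective = injectiveOn-tail mate-injective }
  where open Matching M

Deficient : {R : REL (Fin p) (Fin q) ℓ} → Decidable₂ R → Subset p → Set
Deficient R? L = ∃ λ U → U ⊆ L × ∣ neighbourhood R? U ∣ < ∣ U ∣

_avoiding_ : REL (Fin p) (Fin q) ℓ → Subset q → REL (Fin p) (Fin q) ℓ
(R avoiding Y) i y = R i y × y ∉ Y

_avoiding?_ : {R : REL (Fin p) (Fin q) ℓ} → Decidable₂ R → (Y : Subset q) → Decidable₂ (R avoiding Y)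
(R? avoiding? Y) i y = R? i y ×-dec ¬? (y ∈? Y)

module _ {R : REL (Fin p) (Fin q) ℓ} (R? : Decidable₂ R) where

  neighbourhood⊆∪avoiding : (Y : Subset q) {U : Subset p} →
                            neighbourhood R? U ⊆ Y ∪ neighbourhood (R? avoiding? Y) U
  neighbourhood⊆∪avoiding Y {x = y} y∈NU with ∈-neighbourhood⁻ R? y∈NU | y ∈? Y
  ... | _ , _ , _      | yes y∈Y = x∈p∪q⁺ (inj₁ y∈Y)
  ... | i , i∈U , Riy | no  y∉Y = x∈p∪q⁺ (inj₂ (∈-neighbourhood⁺ (R? avoiding? Y) i∈U (Riy , y∉Y)))

  neighbourhood-∪⊆ : (U W : Subset p) →
    neighbourhood R? (U ∪ W) ⊆ neighbourhood R? U ∪ neighbourhood (R? avoiding? neighbourhood R? U) W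
  neighbourhood-∪⊆ U W y∈ with ∈-neighbourhood⁻ R? y∈
  ... | i , i∈U∪W , Riy with x∈p∪q⁻ U W i∈U∪W
  ...   | inj₁ i∈U = x∈p∪q⁺ (inj₁ (∈-neighbourhood⁺ R? i∈U Riy))
  ...   | inj₂ i∈W = neighbourhood⊆∪avoiding (neighbourhood R? U) (∈-neighbourhood⁺ R? i∈W Riy)

  matching-∅ : {L : Subset p} → Fin q → Empty L → Matching R L
  matching-∅ y ∅ = record
    { mate           = λ _ → y
    ; mate-related   = λ i∈L → contradiction (_ , i∈L) ∅
    ; mate-injective = λ i∈L _ _ → contradiction (_ , i∈L) ∅
    }

  matching-extend : {L : Subset p} {i₀ : Fin p} {y₀ : Fin q} → R i₀ y₀ →
                    Matching (R avoiding ⁅ y₀ ⁆) (L - i₀) → Matching R L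
  matching-extend {L} {i₀} {y₀} Ri₀y₀ M = record
    { mate = mate ; mate-related = related ; mate-injective = injective }
    where
    module M = Matching M
    mate : Fin p → Fin q
    mate i with i ≟ i₀
    ... | yes _ = y₀
    ... | no  _ = M.mate i
    rest : ∀ {i} → i ∈ L → i ≢ i₀ → (R avoiding ⁅ y₀ ⁆) i (M.mate i)
    rest i∈L i≢i₀ = M.mate-related (x∈p∧x≢y⇒x∈p-y i∈L i≢i₀)
    related : ∀ {i} → i ∈ L → R i (mate i)
    related {i} i∈L with i ≟ i₀
    ... | yes refl = Ri₀y₀
    ... | no  i≢i₀ = proj₁ (rest i∈L i≢i₀)
    injective : InjectiveOn L mate
    injective {i} {j} i∈L j∈L eq with i ≟ i₀ | j ≟ i₀
    ... | yes refl | yes refl = refl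
    ... | yes refl | no  j≢i₀ = contradiction (subst (_∈ ⁅ y₀ ⁆) eq (x∈⁅x⁆ y₀)) (proj₂ (rest j∈L j≢i₀))
    ... | no  i≢i₀ | yes refl = contradiction (subst (_∈ ⁅ y₀ ⁆) (sym eq) (x∈⁅x⁆ y₀)) (proj₂ (rest i∈L i≢i₀))
    ... | no  i≢i₀ | no  j≢i₀ = M.mate-injective (x∈p∧x≢y⇒x∈p-y i∈L i≢i₀) (x∈p∧x≢y⇒x∈p-y j∈L j≢i₀) eq

  matching-combine : {L U : Subset p} → Matching R U →
                     Matching (R avoiding neighbourhood R? U) (L ─ U) → Matching R L
  matching-combine {L} {U} M₁ M₂ = record
    { mate = mate ; mate-related = related ; mate-injective = injective }
    where
    module M₁ = Matching M₁
    module M₂ = Matching M₂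
    mate : Fin p → Fin q
    mate i with i ∈? U
    ... | yes _ = M₁.mate i
    ... | no  _ = M₂.mate i
    rest : ∀ {i} → i ∈ L → i ∉ U → (R avoiding neighbourhood R? U) i (M₂.mate i)
    rest i∈L i∉U = M₂.mate-related (x∈p∧x∉q⇒x∈p─q i∈L i∉U)
    related : ∀ {i} → i ∈ L → R i (mate i)
    related {i} i∈L with i ∈? U
    ... | yes i∈U = M₁.mate-related i∈U
    ... | no  i∉U = proj₁ (rest i∈L i∉U)
    mate₁∈N : ∀ {i} → i ∈ U → M₁.mate i ∈ neighbourhood R? U
    mate₁∈N i∈U = ∈-neighbourhood⁺ R? i∈U (M₁.mate-related i∈U)
    injective : InjectiveOn L mate
    injective {i} {j} i∈L j∈L eq with i ∈? U | j ∈? U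
    ... | yes i∈U | yes j∈U = M₁.mate-injective i∈U j∈U eq
    ... | yes i∈U | no  j∉U = contradiction (subst (_∈ _) eq (mate₁∈N i∈U)) (proj₂ (rest j∈L j∉U))
    ... | no  i∉U | yes j∈U = contradiction (subst (_∈ _) (sym eq) (mate₁∈N j∈U)) (proj₂ (rest i∈L i∉U))
    ... | no  i∉U | no  j∉U = M₂.mate-injective (x∈p∧x∉q⇒x∈p─q i∈L i∉U) (x∈p∧x∉q⇒x∈p─q j∈L j∉U) eq

  deficient-mono : {L L′ : Subset p} → L ⊆ L′ → Deficient R? L → Deficient R? L′
  deficient-mono L⊆L′ (U , U⊆L , short) = U , L⊆L′ ∘ U⊆L , short

  deficient-isolated : {L : Subset p} {i : Fin p} → i ∈ L → (∀ y → ¬ R i y) → Deficient R? L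
  deficient-isolated {L} {i} i∈L isolated =
    ⁅ i ⁆ , ⁅i⁆⊆L , subst₂ _<_ (sym (Empty⇒∣p∣≡0 _ no-neighbour)) (sym (∣⁅x⁆∣≡1 i)) (s≤s z≤n)
    where
    ⁅i⁆⊆L : ⁅ i ⁆ ⊆ L
    ⁅i⁆⊆L j∈⁅i⁆ rewrite x∈⁅y⁆⇒x≡y i j∈⁅i⁆ = i∈L
    no-neighbour : Empty (neighbourhood R? ⁅ i ⁆)
    no-neighbour (y , y∈N) with ∈-neighbourhood⁻ R? y∈N
    ... | j , j∈⁅i⁆ , Rjy rewrite x∈⁅y⁆⇒x≡y i j∈⁅i⁆ = isolated y Rjy

  deficient-∪ : {L U : Subset p} → U ⊆ L → ∣ neighbourhood R? U ∣ ≤ ∣ U ∣ →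
                Deficient (R? avoiding? neighbourhood R? U) (L ─ U) → Deficient R? L
  deficient-∪ {L} {U} U⊆L tight (W , W⊆L─U , short) = U ∪ W , ∪-⊆ U⊆L (p─q⊆p L U ∘ W⊆L─U) , (begin-strict
    ∣ neighbourhood R? (U ∪ W) ∣      ≤⟨ p⊆q⇒∣p∣≤∣q∣ (neighbourhood-∪⊆ U W) ⟩
    ∣ neighbourhood R? U ∪ N₂ W ∣     ≤⟨ ∣p∪q∣≤∣p∣+∣q∣ (neighbourhood R? U) (N₂ W) ⟩
    ∣ neighbourhood R? U ∣ + ∣ N₂ W ∣ <⟨ +-mono-≤-< tight short ⟩
    ∣ U ∣ + ∣ W ∣                     ≡⟨ ∣p∪q∣≡∣p∣+∣q∣ U W (λ x∈U x∈W → x∈p─q⇒x∉q L U (W⊆L─U x∈W) x∈U) ⟨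
    ∣ U ∪ W ∣                         ∎)
    where
    open ≤-Reasoning
    N₂ = neighbourhood (R? avoiding? neighbourhood R? U)

  avoiding-deficient⇒tight : {U : Subset p} {y₀ : Fin q} →
    ∣ neighbourhood (R? avoiding? ⁅ y₀ ⁆) U ∣ < ∣ U ∣ → ∣ neighbourhood R? U ∣ ≤ ∣ U ∣
  avoiding-deficient⇒tight {U} {y₀} short = begin
    ∣ neighbourhood R? U ∣ ≤⟨ p⊆q⇒∣p∣≤∣q∣ (neighbourhood⊆∪avoiding ⁅ y₀ ⁆) ⟩
    ∣ ⁅ y₀ ⁆ ∪ N′ U ∣      ≤⟨ ∣p∪q∣≤∣p∣+∣q∣ ⁅ y₀ ⁆ (N′ U) ⟩
    ∣ ⁅ y₀ ⁆ ∣ + ∣ N′ U ∣  ≡⟨ cong (_+ ∣ N′ U ∣) (∣⁅x⁆∣≡1 y₀) ⟩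
    suc ∣ N′ U ∣           ≤⟨ short ⟩
    ∣ U ∣                  ∎
    where
    open ≤-Reasoning
    N′ = neighbourhood (R? avoiding? ⁅ y₀ ⁆)

  hall-critical : {L U : Subset p} → U ⊆ L → ∣ neighbourhood R? U ∣ ≤ ∣ U ∣ →
    Matching R U ⊎ Deficient R? U →
    Matching (R avoiding neighbourhood R? U) (L ─ U) ⊎ Deficient (R? avoiding? neighbourhood R? U) (L ─ U) →
    Matching R L ⊎ Deficient R? L
  hall-critical U⊆L _     (inj₂ d)  _         = inj₂ (deficient-mono U⊆L d)
  hall-critical _   _     (inj₁ M₁) (inj₁ M₂) = inj₁ (matching-combine M₁ M₂)
  hall-critical U⊆L tight (inj₁ _)  (inj₂ d)  = inj₂ (deficient-∪ U⊆L tight d)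

-- A matching is a total function, so a default target y is needed to match the empty set.
hall-acc : Fin q → {L : Subset p} → Acc _⊂_ L →
           {R : REL (Fin p) (Fin q) ℓ} (R? : Decidable₂ R) → Matching R L ⊎ Deficient R? L
hall-acc y {L} (acc smaller) R? with nonempty? L
... | no  ∅           = inj₁ (matching-∅ R? y ∅)
... | yes (i₀ , i₀∈L) with any? (R? i₀)
...   | no  isolated  = inj₂ (deficient-isolated R? i₀∈L λ y₀ Ri₀y₀ → isolated (y₀ , Ri₀y₀))
...   | yes (y₀ , Ri₀y₀) with hall-acc y (smaller (x∈p⇒p-x⊂p i₀∈L)) (R? avoiding? ⁅ y₀ ⁆)
...     | inj₁ M                    = inj₁ (matching-extend R? Ri₀y₀ M)
...     | inj₂ (U , U⊆L-i₀ , short) = hall-critical R? U⊆L (avoiding-deficient⇒tight R? short)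
  (hall-acc y (smaller U⊂L) R?) (hall-acc y (smaller L─U⊂L) (R? avoiding? neighbourhood R? U))
  where
  U⊆L : U ⊆ L
  U⊆L = p─q⊆p L ⁅ i₀ ⁆ ∘ U⊆L-i₀
  U⊂L : U ⊂ L
  U⊂L = ⊆-⊂-trans U⊆L-i₀ (x∈p⇒p-x⊂p i₀∈L)
  L─U⊂L : L ─ U ⊂ L
  L─U⊂L with ∣p∣>0⇒Nonempty U (≤-<-trans z≤n short)
  ... | x , x∈U = p∩q≢∅⇒p─q⊂p L U (x , x∈p∩q⁺ (U⊆L x∈U , x∈U))

hall : {R : REL (Fin p) (Fin q) ℓ} → Fin q → (R? : Decidable₂ R) (L : Subset p) → Matching R L ⊎ Deficient R? L
hall y R? L = hall-acc y (⊂-wellFounded L) R?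

InjectiveBelow : {A : Set ℓ} → ℕ → (ℕ → A) → Set ℓ
InjectiveBelow N f = ∀ {s t} → s < N → t < N → f s ≡ f t → s ≡ t

closed-walk⇒cycle : (G : Graph n) {N : ℕ} (f : ℕ → Fin n) → 3 ≤ N → InjectiveBelow N f →
                    (∀ {t} → t < N → Adjacent G (f t) (f (suc t))) → f N ≡ f 0 → HasCycleOfLength G N
closed-walk⇒cycle G {suc N} f 3≤N injective adjacent closed =
  3≤N , f ∘ toℕ , (λ {i} {j} eq → toℕ-injective (injective (toℕ<n i) (toℕ<n j) eq)) ,
  (λ i → subst (λ t → Adjacent G (f t) (f (suc (toℕ i)))) (sym (toℕ-inject₁ i))
               (adjacent (m<n⇒m<1+n (toℕ<n i)))) ,
  subst₂ (λ s t → Adjacent G (f s) t) (sym (toℕ-fromℕ N)) closed (adjacent (n<1+n N))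

interleave : {A : Set ℓ} → (ℕ → A) → (ℕ → A) → ℕ → A
interleave e o zero          = e zero
interleave e o (suc zero)    = o zero
interleave e o (suc (suc t)) = interleave (e ∘ suc) (o ∘ suc) t

interleave-even : {A : Set ℓ} (e o : ℕ → A) → ∀ u → interleave e o (u + u) ≡ e u
interleave-even e o zero    = refl
interleave-even e o (suc u) rewrite +-suc u u = interleave-even (e ∘ suc) (o ∘ suc) u

interleave-odd : {A : Set ℓ} (e o : ℕ → A) → ∀ u → interleave e o (suc (u + u)) ≡ o u
interleave-odd e o zero    = refl
interleave-odd e o (suc u) rewrite +-suc u u = interleave-odd (e ∘ suc) (o ∘ suc) u

data Parity : ℕ → Set where
  even : ∀ u → Parity (u + u)
  odd  : ∀ u → Parity (suc (u + u))

parity : ∀ t → Parity t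
parity zero          = even zero
parity (suc zero)    = odd zero
parity (suc (suc t)) with parity t
... | even u = subst Parity (cong suc (+-suc u u)) (even (suc u))
... | odd  u = subst Parity (cong (λ t → suc (suc t)) (+-suc u u)) (odd (suc u))

half< : ∀ {u t N} → u + u ≤ t → t < N + N → u < N
half< {u} {t} {N} u+u≤t t<N+N with u <? N
... | yes u<N = u<N
... | no  u≮N = contradiction (≤-<-trans (+-mono-≤ (≮⇒≥ u≮N) (≮⇒≥ u≮N)) (≤-<-trans u+u≤t t<N+N)) (<-irrefl refl)

alternating-cycle : (G : Graph n) (e o : ℕ → Fin n) {N : ℕ} → 2 ≤ N →
  InjectiveBelow N e → InjectiveBelow N o → (∀ {u v} → u < N → v < N → e u ≢ o v) →
  (∀ u → Adjacent G (e u) (o u)) → (∀ u → Adjacent G (o u) (e (suc u))) → e N ≡ e 0 →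
  HasCycleOfLength G (N + N)
alternating-cycle G e o {N} 2≤N e-injective o-injective e≢o e~o o~e closed =
  closed-walk⇒cycle G (interleave e o) (≤-trans (n≤1+n 3) (+-mono-≤ 2≤N 2≤N)) injective adjacent
    (trans (interleave-even e o N) closed)
  where
  adjacent : ∀ {t} → t < N + N → Adjacent G (interleave e o t) (interleave e o (suc t))
  adjacent {t} _ with parity t
  ... | even u = subst₂ (Adjacent G) (sym (interleave-even e o u)) (sym (interleave-odd e o u)) (e~o u)
  ... | odd  u = subst₂ (Adjacent G) (sym (interleave-odd e o u)) (sym (interleave-even (e ∘ suc) (o ∘ suc) u))
                        (o~e u)
  injective : InjectiveBelow (N + N) (interleave e o)
  injective {s} {t} s< t< eq with parity s | parity t
  ... | even u | even v = cong (λ w → w + w) (e-injective (half< ≤-refl s<) (half< ≤-refl t<)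
          (trans (sym (interleave-even e o u)) (trans eq (interleave-even e o v))))
  ... | odd  u | odd  v = cong (λ w → suc (w + w)) (o-injective (half< (n≤1+n _) s<) (half< (n≤1+n _) t<)
          (trans (sym (interleave-odd e o u)) (trans eq (interleave-odd e o v))))
  ... | even u | odd  v = contradiction (trans (sym (interleave-even e o u)) (trans eq (interleave-odd e o v)))
          (e≢o (half< ≤-refl s<) (half< (n≤1+n _) t<))
  ... | odd  u | even v = contradiction (trans (sym (interleave-even e o v)) (trans (sym eq) (interleave-odd e o u)))
          (e≢o (half< ≤-refl t<) (half< (n≤1+n _) s<))

alternating⇒even : (s : ℕ → Bool) → (∀ t → s (suc t) ≡ not (s t)) → ∀ N → s N ≡ s 0 → ∃ λ k → N ≡ k + k
alternating⇒even s alternates zero          _     = zero , refl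
alternating⇒even s alternates (suc zero)    s₁≡s₀ = contradiction (trans (sym s₁≡s₀) (alternates 0)) (not-¬ refl)
alternating⇒even s alternates (suc (suc N)) returns
  with alternating⇒even (λ t → s (suc (suc t))) (λ t → alternates (suc (suc t))) N returns′
  where
  returns′ : s (suc (suc N)) ≡ s 2
  returns′ = trans returns (sym (trans (alternates 1) (trans (cong not (alternates 0)) (not-involutive (s 0)))))
... | k , N≡k+k = suc k , trans (cong (λ t → suc (suc t)) N≡k+k) (cong suc (sym (+-suc k k)))

injectiveBelow⇒≤ : {w : ℕ → Fin n} {N : ℕ} → InjectiveBelow N w → N ≤ n
injectiveBelow⇒≤ {w = w} injective =
  injective⇒≤ {f = w ∘ toℕ} λ {i} {j} eq → toℕ-injective (injective (toℕ<n i) (toℕ<n j) eq)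

module _ (w : ℕ → Fin n) where

  private
    Fresh : ℕ → Set
    Fresh j = ∀ {i} → i < j → w i ≢ w j

  repeat? : ∀ j → (∃ λ i → i < j × w i ≡ w j) ⊎ Fresh j
  repeat? j with any? (λ (i : Fin j) → w (toℕ i) ≟ w j)
  ... | yes (i , eq) = inj₁ (toℕ i , toℕ<n i , eq)
  ... | no  none     = inj₂ λ i<j eq → none (fromℕ< i<j , subst (λ i → w i ≡ w _) (sym (toℕ-fromℕ< i<j)) eq)

  injectiveBelow-suc : ∀ {j} → InjectiveBelow j w → Fresh j → InjectiveBelow (suc j) w
  injectiveBelow-suc injective fresh s≤j t≤j eq with m<1+n⇒m<n∨m≡n s≤j | m<1+n⇒m<n∨m≡n t≤j
  ... | inj₁ s<j  | inj₁ t<j  = injective s<j t<j eq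
  ... | inj₁ s<j  | inj₂ refl = contradiction eq (fresh s<j)
  ... | inj₂ refl | inj₁ t<j  = contradiction (sym eq) (fresh t<j)
  ... | inj₂ refl | inj₂ refl = refl

  first-repeat-from : ∀ fuel j → n < j + fuel → InjectiveBelow j w →
                      ∃₂ λ i j′ → i < j′ × w i ≡ w j′ × InjectiveBelow j′ w
  first-repeat-from zero       j n<j injective =
    contradiction (injectiveBelow⇒≤ injective) (<⇒≱ (subst (n <_) (+-identityʳ j) n<j))
  first-repeat-from (suc fuel) j bound injective with repeat? j
  ... | inj₁ (i , i<j , eq) = i , j , i<j , eq , injective
  ... | inj₂ fresh          =
    first-repeat-from fuel (suc j) (subst (n <_) (+-suc j fuel) bound) (injectiveBelow-suc injective fresh)

  returning-segment : ∃₂ λ a N → 0 < N × w (a + N) ≡ w (a + 0) × InjectiveBelow N (λ u → w (a + u))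
  returning-segment with first-repeat-from (suc n) 0 (n<1+n n) (λ ())
  ... | a , j , a<j , wa≡wj , injective =
    a , j ∸ a , m<n⇒0<n∸m a<j ,
    trans (cong w (m+[n∸m]≡n (<⇒≤ a<j))) (sym (trans (cong w (+-identityʳ a)) wa≡wj)) ,
    λ u< v< eq → +-cancelˡ-≡ a _ _ (injective (shifted u<) (shifted v<) eq)
    where
    shifted : ∀ {u} → u < j ∸ a → a + u < j
    shifted u< = subst (_ <_) (m+[n∸m]≡n (<⇒≤ a<j)) (+-monoʳ-< a u<)

record IndexedMatching (G : Graph n) (I : Subset n) : Set where
  field
    row column       : Fin n → Fin n
    row-injective    : InjectiveOn I row
    column-injective : InjectiveOn I column
    column≢row       : ∀ {i j} → i ∈ I → j ∈ I → column i ≢ row j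
    column~row       : ∀ {i} → i ∈ I → Adjacent G (column i) (row i)

adjacent-sym : (G : Graph n) {u v : Fin n} → Adjacent G u v → Adjacent G v u
adjacent-sym G {u} {v} u~v = trans (adj-sym G v u) u~v

module _ {G : Graph n} (free : IsC4kFree G) {I : Subset n} (M : IndexedMatching G I) (x : Fin n → ℚ)
  (row-equations : ∀ {i} → i ∈ I → adjMatrix G (IndexedMatching.row M i) · x ≡ 0ℚ)
  (rows-see-columns : ∀ {i j} → i ∈ I → Adjacent G (IndexedMatching.row M i) j → x j ≢ 0ℚ →
                      ∃ λ i′ → i′ ∈ I × IndexedMatching.column M i′ ≡ j)
  where

  open IndexedMatching M

  private
    Live : Fin n → Set
    Live i = i ∈ I × x (column i) ≢ 0ℚ

    σ : Fin n → Bool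
    σ i = sign (x (column i))

    step : ∀ {i} → Live i → ∃ λ i′ → Live i′ × Adjacent G (row i) (column i′) × σ i′ ≡ not (σ i)
    step (i∈I , live) with opposite-sign-neighbour G x (row-equations i∈I) (adjacent-sym G (column~row i∈I)) live
    ... | j , row~j , xⱼ≢0 , flipped with rows-see-columns i∈I row~j xⱼ≢0
    ...   | i′ , i′∈I , refl = i′ , (i′∈I , xⱼ≢0) , row~j , flipped

    walk : Σ (Fin n) Live → ℕ → Σ (Fin n) Live
    walk start zero    = start
    walk start (suc t) = let (i′ , live′ , _) = step (proj₂ (walk start t)) in i′ , live′

    module _ (start : Σ (Fin n) Live) (a : ℕ) where

      shifted : ℕ → Fin n
      shifted u = proj₁ (walk start (a + u))

      shifted∈I : ∀ u → shifted u ∈ I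
      shifted∈I u = proj₁ (proj₂ (walk start (a + u)))

      shifted-step : ∀ u → Adjacent G (row (shifted u)) (column (shifted (suc u)))
                         × σ (shifted (suc u)) ≡ not (σ (shifted u))
      shifted-step u rewrite +-suc a u = proj₂ (proj₂ (step (proj₂ (walk start (a + u)))))

    N+N≡4k : ∀ {N k} → N ≡ k + k → N + N ≡ 4 * k
    N+N≡4k {k = k} refl = solve 1 (λ k → (k :+ k) :+ (k :+ k) := con 4 :* k) refl k

    -- The walk returns to a vertex after N matched edges; the sign of x alternates along it,
    -- so N is even and the walk traces a cycle of length 2N ≡ 0 (mod 4).
    no-live-column : ∀ {i} → Live i → ⊥
    no-live-column {i} live with returning-segment (proj₁ ∘ walk (i , live))
    ... | a , N , 0<N , returns , injective
        with alternating⇒even (σ ∘ shifted (i , live) a) (proj₂ ∘ shifted-step (i , live) a) N (cong σ returns)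
    ...   | zero  , refl  = <-irrefl refl 0<N
    ...   | suc k , N≡k+k = free (suc k) (s≤s z≤n) (subst (HasCycleOfLength G) (N+N≡4k {k = suc k} N≡k+k) cycle)
      where
      w : ℕ → Fin n
      w = shifted (i , live) a
      w∈I : ∀ u → w u ∈ I
      w∈I = shifted∈I (i , live) a
      cycle : HasCycleOfLength G (N + N)
      cycle = alternating-cycle G (column ∘ w) (row ∘ w) (subst (2 ≤_) (sym N≡k+k) (+-mono-≤ (s≤s z≤n) (s≤s z≤n)))
        (λ u< v< eq → injective u< v< (column-injective (w∈I _) (w∈I _) eq))
        (λ u< v< eq → injective u< v< (row-injective (w∈I _) (w∈I _) eq))
        (λ _ _ → column≢row (w∈I _) (w∈I _))
        (column~row ∘ w∈I)
        (proj₁ ∘ shifted-step (i , live) a)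
        (cong column returns)

  columns-vanish : ∀ {i} → i ∈ I → x (column i) ≡ 0ℚ
  columns-vanish {i} i∈I with x (column i) ℚ.≟ 0ℚ
  ... | yes xᵢ≡0 = xᵢ≡0
  ... | no  xᵢ≢0 = ⊥-elim (no-live-column (i∈I , xᵢ≢0))

independent? : (G : Graph n) (S : Subset n) → Dec (IsIndependent G S)
independent? G S = all? λ u → all? λ v → u ∈? S →-dec v ∈? S →-dec ¬? (adj G u v Bool.≟ true)

maximum-independent-set : (G : Graph n) → ∃ (IsMaximumIndependent G)
maximum-independent-set G = largest (independent? G) {∅} λ u v u∈∅ → contradiction u∈∅ ∉⊥

module BipartiteC4kFree {G : Graph n} (colour : Fin n → Bool)
                        (proper : ∀ u v → Adjacent G u v → colour u ≢ colour v) (free : IsC4kFree G) where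

  colour-flip : ∀ {u v b} → Adjacent G u v → colour u ≡ b → colour v ≡ not b
  colour-flip {u} {v} u~v refl = ¬-not λ eq → proper u v u~v (sym eq)

  AdjacentIn : Subset n → REL (Fin n) (Fin n) _
  AdjacentIn S u w = Adjacent G u w × w ∈ S

  adjacentIn? : (S : Subset n) → Decidable₂ (AdjacentIn S)
  adjacentIn? S u w = (adj G u w Bool.≟ true) ×-dec (w ∈? S)

  Outside : Subset n → Bool → Subset n
  Outside S b = select λ v → (colour v Bool.≟ b) ×-dec ¬? (v ∈? S)

  module _ {S : Subset n} {b : Bool} where

    ∈-Outside⁺ : ∀ {v} → colour v ≡ b → v ∉ S → v ∈ Outside S b
    ∈-Outside⁺ colour≡b v∉S = ∈-select⁺ _ (colour≡b , v∉S)

    ∈-Outside⁻ : ∀ {v} → v ∈ Outside S b → colour v ≡ b × v ∉ S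
    ∈-Outside⁻ = ∈-select⁻ _

  module _ {S U N : Subset n} {b : Bool} (U⊆ : U ⊆ Outside S b)
           (covers : ∀ {u w} → u ∈ U → w ∈ S → Adjacent G u w → w ∈ N) where

    exchange-independent : IsIndependent G S → IsIndependent G ((S ─ N) ∪ U)
    exchange-independent S-indep u v u∈ v∈ u~v with x∈p∪q⁻ (S ─ N) U u∈ | x∈p∪q⁻ (S ─ N) U v∈
    ... | inj₁ u∈S─N | inj₁ v∈S─N = S-indep u v (p─q⊆p S N u∈S─N) (p─q⊆p S N v∈S─N) u~v
    ... | inj₂ u∈U   | inj₂ v∈U   =
      proper u v u~v (trans (proj₁ (∈-Outside⁻ (U⊆ u∈U))) (sym (proj₁ (∈-Outside⁻ (U⊆ v∈U)))))
    ... | inj₂ u∈U   | inj₁ v∈S─N = x∈p─q⇒x∉q S N v∈S─N (covers u∈U (p─q⊆p S N v∈S─N) u~v)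
    ... | inj₁ u∈S─N | inj₂ v∈U   = x∈p─q⇒x∉q S N u∈S─N (covers v∈U (p─q⊆p S N u∈S─N) (adjacent-sym G u~v))

    exchange-size : ∣ S ∣ + ∣ U ∣ ≤ ∣ (S ─ N) ∪ U ∣ + ∣ N ∣
    exchange-size = begin
      ∣ S ∣ + ∣ U ∣               ≤⟨ +-monoˡ-≤ ∣ U ∣ (∣p∣≤∣p─q∣+∣q∣ S N) ⟩
      ∣ S ─ N ∣ + ∣ N ∣ + ∣ U ∣   ≡⟨ solve 3 (λ a b c → a :+ b :+ c := a :+ c :+ b) refl
                                            (∣ S ─ N ∣) (∣ N ∣) (∣ U ∣) ⟩
      ∣ S ─ N ∣ + ∣ U ∣ + ∣ N ∣   ≡⟨ cong (_+ ∣ N ∣) (∣p∪q∣≡∣p∣+∣q∣ (S ─ N) U S─N∩U=∅) ⟨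
      ∣ (S ─ N) ∪ U ∣ + ∣ N ∣     ∎
      where
      open ≤-Reasoning
      S─N∩U=∅ : Disjoint (S ─ N) U
      S─N∩U=∅ x∈S─N x∈U = proj₂ (∈-Outside⁻ (U⊆ x∈U)) (p─q⊆p S N x∈S─N)

    exchange-maximum : IsMaximumIndependent G S → ∣ N ∣ ≤ ∣ U ∣ → IsMaximumIndependent G ((S ─ N) ∪ U)
    exchange-maximum (S-indep , S-max) ∣N∣≤∣U∣ = exchange-independent S-indep , λ T T-indep →
      ≤-trans (S-max T T-indep) (+-cancelʳ-≤ (∣ U ∣) (∣ S ∣) _ (≤-trans exchange-size (+-monoʳ-≤ _ ∣N∣≤∣U∣)))

    exchange-deficient : IsMaximumIndependent G S → ∣ N ∣ < ∣ U ∣ → ⊥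
    exchange-deficient (S-indep , S-max) ∣N∣<∣U∣ = <-irrefl refl (begin-strict
      ∣ S ∣ + ∣ U ∣               ≤⟨ exchange-size ⟩
      ∣ (S ─ N) ∪ U ∣ + ∣ N ∣     <⟨ +-monoʳ-< _ ∣N∣<∣U∣ ⟩
      ∣ (S ─ N) ∪ U ∣ + ∣ U ∣     ≤⟨ +-monoˡ-≤ ∣ U ∣ (S-max _ (exchange-independent S-indep)) ⟩
      ∣ S ∣ + ∣ U ∣               ∎)
      where open ≤-Reasoning

  null-vanishes-outside : ∀ {S} → IsMaximumIndependent G S → ∀ {x} → InNull G x → ∀ {v} → v ∉ S → x v ≡ 0ℚ
  null-vanishes-outside {S} S-max@(S-indep , _) {x} null {v} v∉S
    with hall v (adjacentIn? S) (Outside S (colour v))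
  ... | inj₂ (U , U⊆ , deficient) =
    ⊥-elim (exchange-deficient U⊆ (λ u∈U w∈S u~w → ∈-neighbourhood⁺ (adjacentIn? S) u∈U (u~w , w∈S))
                               S-max deficient)
  ... | inj₁ M = columns-vanish free matched x (λ _ → null _) rows-see-columns (∈-Outside⁺ refl v∉S)
    where
    open Matching M
    L = Outside S (colour v)
    matched : IndexedMatching G L
    matched = record
      { row = mate ; column = λ i → i
      ; row-injective = mate-injective ; column-injective = λ _ _ eq → eq
      ; column≢row = λ i∈L j∈L i≡mateⱼ →
          proj₂ (∈-Outside⁻ i∈L) (subst (_∈ S) (sym i≡mateⱼ) (proj₂ (mate-related j∈L)))
      ; column~row = λ i∈L → proj₁ (mate-related i∈L)
      }
    rows-see-columns : ∀ {i j} → i ∈ L → Adjacent G (mate i) j → x j ≢ 0ℚ → ∃ λ i′ → i′ ∈ L × i′ ≡ j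
    rows-see-columns {i} {j} i∈L mateᵢ~j _ = j , ∈-Outside⁺ colourⱼ j∉S , refl
      where
      colourⱼ : colour j ≡ colour v
      colourⱼ = trans (colour-flip mateᵢ~j (colour-flip (proj₁ (mate-related i∈L)) (proj₁ (∈-Outside⁻ i∈L))))
                      (not-involutive _)
      j∉S : j ∉ S
      j∉S j∈S = S-indep (mate i) j (proj₂ (mate-related i∈L)) j∈S mateᵢ~j

  solution⇒null : ∀ {S b U} → IsIndependent G S → (∀ {j} → j ∈ U → j ∈ S × colour j ≡ not b) →
    ∀ {z} → (∀ {j} → j ∉ U → z j ≡ 0ℚ) → (∀ {u} → u ∈ Outside S b → adjMatrix G u · z ≡ 0ℚ) → InNull G z
  solution⇒null {S} {b} {U} S-indep U-side {z} supported solves u with u ∈? Outside S b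
  ... | yes u∈L = solves u∈L
  ... | no  u∉L = ·-zero (adjMatrix G u) z silent
    where
    silent : ∀ j → adjMatrix G u j ≡ 0ℚ ⊎ z j ≡ 0ℚ
    silent j with adj G u j in u~j | j ∈? U
    ... | false | _       = inj₁ refl
    ... | true  | no  j∉U = inj₂ (supported j∉U)
    ... | true  | yes j∈U = contradiction (∈-Outside⁺ colourᵤ u∉S) u∉L
      where
      colourᵤ : colour u ≡ b
      colourᵤ = trans (colour-flip (adjacent-sym G u~j) (proj₂ (U-side j∈U))) (not-involutive b)
      u∉S : u ∉ S
      u∉S u∈S = S-indep u j u∈S (proj₁ (U-side j∈U)) u~j

  -- The ∣L∣ equations at L in the ∣L∣ + 1 unknowns on U have a nonzero solution, which is a null
  -- vector; by columns-vanish it can only be nonzero at w.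
  surplus-in-support : ∀ {S b} → IsIndependent G S → (M : Matching (AdjacentIn S) (Outside S b)) →
    ∀ {w} → w ∈ S → colour w ≡ not b → w ∉ image (Matching.mate M) (Outside S b) → InSupp G w
  surplus-in-support {S} {b} S-indep M {w} w∈S colour-w w-unmatched = vector , null , vector-w≢0
    where
    open Matching M
    L = Outside S b
    U = image mate L ∪ ⁅ w ⁆

    U-cases : ∀ {j} → j ∈ U → (∃ λ i → i ∈ L × mate i ≡ j) ⊎ j ≡ w
    U-cases j∈U with x∈p∪q⁻ (image mate L) ⁅ w ⁆ j∈U
    ... | inj₁ j∈image = inj₁ (∈-image⁻ mate j∈image)
    ... | inj₂ j∈⁅w⁆   = inj₂ (x∈⁅y⁆⇒x≡y w j∈⁅w⁆)

    U-side : ∀ {j} → j ∈ U → j ∈ S × colour j ≡ not b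
    U-side j∈U with U-cases j∈U
    ... | inj₁ (i , i∈L , refl) =
      proj₂ (mate-related i∈L) , colour-flip (proj₁ (mate-related i∈L)) (proj₁ (∈-Outside⁻ i∈L))
    ... | inj₂ refl             = w∈S , colour-w

    ∣L∣<∣U∣ : ∣ L ∣ < ∣ U ∣
    ∣L∣<∣U∣ = subst (∣ L ∣ <_) (sym (x∉p⇒∣p∪⁅x⁆∣≡1+∣p∣ (image mate L) w-unmatched))
                    (s≤s (∣p∣≤∣image∣ mate L mate-injective))

    open NonzeroSolution (nonzero-solution (adjMatrix G) L U ∣L∣<∣U∣)

    in-U : ∀ {j} → vector j ≢ 0ℚ → j ∈ U
    in-U {j} zⱼ≢0 with j ∈? U
    ... | yes j∈U = j∈U
    ... | no  j∉U = contradiction (supported j∉U) zⱼ≢0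

    null : InNull G vector
    null = solution⇒null S-indep U-side supported solves

    matched : IndexedMatching G L
    matched = record
      { row = λ i → i ; column = mate
      ; row-injective = λ _ _ eq → eq ; column-injective = mate-injective
      ; column≢row = λ i∈L j∈L mateᵢ≡j →
          proj₂ (∈-Outside⁻ j∈L) (subst (_∈ S) mateᵢ≡j (proj₂ (mate-related i∈L)))
      ; column~row = λ i∈L → adjacent-sym G (proj₁ (mate-related i∈L))
      }

    vector-w≢0 : vector w ≢ 0ℚ
    vector-w≢0 z-w≡0 with nonzero
    ... | j , zⱼ≢0 with U-cases (in-U zⱼ≢0)
    ...   | inj₂ refl             = zⱼ≢0 z-w≡0
    ...   | inj₁ (i , i∈L , refl) = zⱼ≢0 (columns-vanish free matched vector (λ _ → null _) rows-see-columns i∈L)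
      where
      rows-see-columns : ∀ {i j} → i ∈ L → Adjacent G i j → vector j ≢ 0ℚ → ∃ λ i′ → i′ ∈ L × mate i′ ≡ j
      rows-see-columns _ _ zⱼ≢0 with U-cases (in-U zⱼ≢0)
      ... | inj₁ matched-j = matched-j
      ... | inj₂ refl      = contradiction z-w≡0 zⱼ≢0

  avoidable-or-support : ∀ {S} → IsMaximumIndependent G S → ∀ {v} → v ∈ S →
                         (∃ λ S′ → IsMaximumIndependent G S′ × v ∉ S′) ⊎ InSupp G v
  avoidable-or-support {S} S-max@(S-indep , _) {v} v∈S
    with hall v (adjacentIn? (S - v)) (Outside S (not (colour v)))
  ... | inj₁ M = inj₂ (surplus-in-support S-indep (matching-map (λ (u~w , w∈S-v) → u~w , p─q⊆p S ⁅ v ⁆ w∈S-v) M)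
                                          v∈S (sym (not-involutive (colour v))) v-unmatched)
    where
    open Matching M
    v-unmatched : v ∉ image mate (Outside S (not (colour v)))
    v-unmatched v∈image with ∈-image⁻ mate v∈image
    ... | i , i∈L , mateᵢ≡v = x∈p─q⇒x∉q S ⁅ v ⁆ (proj₂ (mate-related i∈L)) (subst (_∈ ⁅ v ⁆) (sym mateᵢ≡v) (x∈⁅x⁆ v))
  ... | inj₂ (W , W⊆ , deficient) =
    inj₁ ((S ─ N) ∪ W , exchange-maximum W⊆ covers S-max ∣N∣≤∣W∣ , v∉S─N∪W)
    where
    N′ = neighbourhood (adjacentIn? (S - v)) W
    N = N′ ∪ ⁅ v ⁆
    covers : ∀ {u w} → u ∈ W → w ∈ S → Adjacent G u w → w ∈ N
    covers {w = w} u∈W w∈S u~w with w ≟ v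
    ... | yes refl = x∈p∪q⁺ (inj₂ (x∈⁅x⁆ v))
    ... | no  w≢v  = x∈p∪q⁺ (inj₁ (∈-neighbourhood⁺ _ u∈W (u~w , x∈p∧x≢y⇒x∈p-y w∈S w≢v)))
    ∣N∣≤∣W∣ : ∣ N ∣ ≤ ∣ W ∣
    ∣N∣≤∣W∣ = ≤-trans (∣p∪q∣≤∣p∣+∣q∣ N′ ⁅ v ⁆)
                      (subst (_≤ ∣ W ∣) (trans (+-comm 1 ∣ N′ ∣) (cong (∣ N′ ∣ +_) (sym (∣⁅x⁆∣≡1 v)))) deficient)
    v∉S─N∪W : v ∉ (S ─ N) ∪ W
    v∉S─N∪W v∈ with x∈p∪q⁻ (S ─ N) W v∈
    ... | inj₁ v∈S─N = x∈p─q⇒x∉q S N v∈S─N (x∈p∪q⁺ (inj₂ (x∈⁅x⁆ v)))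
    ... | inj₂ v∈W   = proj₂ (∈-Outside⁻ (W⊆ v∈W)) v∈S

  includable : ∀ {S} → IsMaximumIndependent G S → ∀ {v} → v ∉ S → ∀ {U N} → U ⊆ Outside S (colour v) →
    (∀ {u w} → u ∈ U → w ∈ S → Adjacent G u w → w ∈ N) → (∀ {w} → w ∈ S → Adjacent G v w → w ∈ N) →
    ∣ N ∣ ≤ ∣ U ∣ → ∃ λ S′ → IsMaximumIndependent G S′ × v ∈ S′
  includable {S} S-max {v} v∉S {U} {N} U⊆ covers-U covers-v ∣N∣≤∣U∣ =
    (S ─ N) ∪ (U ∪ ⁅ v ⁆) ,
    exchange-maximum U∪v⊆ covers S-max (≤-trans ∣N∣≤∣U∣ (∣p∣≤∣p∪q∣ U ⁅ v ⁆)) ,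
    x∈p∪q⁺ (inj₂ (x∈p∪q⁺ (inj₂ (x∈⁅x⁆ v))))
    where
    U∪v⊆ : U ∪ ⁅ v ⁆ ⊆ Outside S (colour v)
    U∪v⊆ = ∪-⊆ U⊆ λ x∈⁅v⁆ → subst (_∈ _) (sym (x∈⁅y⁆⇒x≡y v x∈⁅v⁆)) (∈-Outside⁺ refl v∉S)
    covers : ∀ {u w} → u ∈ U ∪ ⁅ v ⁆ → w ∈ S → Adjacent G u w → w ∈ N
    covers u∈ w∈S u~w with x∈p∪q⁻ U ⁅ v ⁆ u∈
    ... | inj₁ u∈U   = covers-U u∈U w∈S u~w
    ... | inj₂ u∈⁅v⁆ rewrite x∈⁅y⁆⇒x≡y v u∈⁅v⁆ = covers-v w∈S u~w

  -- v is listed twice, as zero and as suc v, so that a matching gives v two distinct mates in S.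
  duplicate : Fin n → Fin (suc n) → Fin n
  duplicate v zero    = v
  duplicate v (suc i) = i

  adjacentIn⁺? : (S : Subset n) (v : Fin n) → Decidable₂ (λ k → AdjacentIn S (duplicate v k))
  adjacentIn⁺? S v k = adjacentIn? S (duplicate v k)

  doubled-deficient⇒includable : ∀ {S} → IsMaximumIndependent G S → ∀ {v} → v ∉ S → ∀ {U⁺} →
    U⁺ ⊆ inside ∷ Outside S (colour v) → ∣ neighbourhood (adjacentIn⁺? S v) U⁺ ∣ < ∣ U⁺ ∣ →
    ∃ λ S′ → IsMaximumIndependent G S′ × v ∈ S′
  doubled-deficient⇒includable S-max v∉S {inside ∷ U} U⁺⊆ deficient =
    includable S-max v∉S (drop-there ∘ U⁺⊆ ∘ there)
      (λ u∈U w∈S u~w → ∈-neighbourhood⁺ (adjacentIn⁺? _ _) (there u∈U) (u~w , w∈S))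
      (λ w∈S v~w → ∈-neighbourhood⁺ (adjacentIn⁺? _ _) here (v~w , w∈S))
      (≤-pred deficient)
  doubled-deficient⇒includable S-max v∉S {outside ∷ U} U⁺⊆ deficient =
    ⊥-elim (exchange-deficient (drop-there ∘ U⁺⊆ ∘ there)
      (λ u∈U w∈S u~w → ∈-neighbourhood⁺ (adjacentIn⁺? _ _) (there u∈U) (u~w , w∈S)) S-max deficient)

  includable-or-core : ∀ {S} → IsMaximumIndependent G S → ∀ {v} → v ∉ S →
                       (∃ λ S′ → IsMaximumIndependent G S′ × v ∈ S′) ⊎ InCore G v
  includable-or-core {S} S-max@(S-indep , _) {v} v∉S
    with hall v (adjacentIn⁺? S v) (inside ∷ Outside S (colour v))
  ... | inj₁ M⁺ = inj₂ (mate zero , v~mate₀ , surplus-in-support S-indep (matching-tail M⁺)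
                                                (proj₂ (mate-related here)) (colour-flip v~mate₀ refl) unmatched)
    where
    open Matching M⁺
    v~mate₀ : Adjacent G v (mate zero)
    v~mate₀ = proj₁ (mate-related here)
    unmatched : mate zero ∉ image (mate ∘ suc) (Outside S (colour v))
    unmatched mate₀∈ with ∈-image⁻ (mate ∘ suc) mate₀∈
    ... | i , i∈L , eq with mate-injective (there i∈L) here eq
    ... | ()
  ... | inj₂ (U⁺ , U⁺⊆ , deficient) = inj₁ (doubled-deficient⇒includable S-max v∉S U⁺⊆ deficient)

  support⊆maximum : ∀ {v} → InSupp G v → ∀ S → IsMaximumIndependent G S → v ∈ S
  support⊆maximum {v} (x , null , xᵥ≢0) S S-max with v ∈? S
  ... | yes v∈S = v∈S
  ... | no  v∉S = contradiction (null-vanishes-outside S-max null v∉S) xᵥ≢0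

  core∩maximum≡∅ : ∀ {v} → InCore G v → ∀ S → IsMaximumIndependent G S → v ∉ S
  core∩maximum≡∅ {v} (u , v~u , u-supp) S S-max v∈S =
    proj₁ S-max v u v∈S (support⊆maximum u-supp S S-max) v~u

  support-or-avoidable : ∀ v → InSupp G v ⊎ ∃ λ S → IsMaximumIndependent G S × v ∉ S
  support-or-avoidable v with maximum-independent-set G
  ... | S , S-max with v ∈? S
  ...   | yes v∈S = swap (avoidable-or-support S-max v∈S)
  ...   | no  v∉S = inj₂ (S , S-max , v∉S)

  core-or-includable : ∀ v → InCore G v ⊎ ∃ λ S → IsMaximumIndependent G S × v ∈ S
  core-or-includable v with maximum-independent-set G
  ... | S , S-max with v ∈? S
  ...   | yes v∈S = inj₂ (S , S-max , v∈S)
  ...   | no  v∉S = swap (includable-or-core S-max v∉S)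

theorem6p5 : ∀ {n : ℕ} (G : Graph n) → IsBipartite G → IsC4kFree G → ∀ (v : Fin n) →
    (InSupp G v ⇔ (∀ (S : Subset n) → IsMaximumIndependent G S → v ∈ S))
  × (InCore G v ⇔ (∀ (S : Subset n) → IsMaximumIndependent G S → v ∉ S))
  × (InNpart G v ⇔ ((∃[ S ] (IsMaximumIndependent G S × v ∈ S)) × (∃[ S ] (IsMaximumIndependent G S × v ∉ S))))
theorem6p5 G (colour , proper) free v =
  mk⇔ support⊆maximum in-every⇒support , mk⇔ core∩maximum≡∅ in-none⇒core , mk⇔ npart⇒both both⇒npart
  where
  open BipartiteC4kFree colour proper free

  in-every⇒support : (∀ S → IsMaximumIndependent G S → v ∈ S) → InSupp G v
  in-every⇒support in-every =
    [ id , (λ (S , S-max , v∉S) → contradiction (in-every S S-max) v∉S) ] (support-or-avoidable v)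

  in-none⇒core : (∀ S → IsMaximumIndependent G S → v ∉ S) → InCore G v
  in-none⇒core in-none =
    [ id , (λ (S , S-max , v∈S) → contradiction v∈S (in-none S S-max)) ] (core-or-includable v)

  npart⇒both : InNpart G v →
               (∃[ S ] (IsMaximumIndependent G S × v ∈ S)) × (∃[ S ] (IsMaximumIndependent G S × v ∉ S))
  npart⇒both (¬supp , ¬core) =
    [ ⊥-elim ∘ ¬core , id ] (core-or-includable v) , [ ⊥-elim ∘ ¬supp , id ] (support-or-avoidable v)

  both⇒npart : (∃[ S ] (IsMaximumIndependent G S × v ∈ S)) × (∃[ S ] (IsMaximumIndependent G S × v ∉ S)) →
               InNpart G v
  both⇒npart ((S₁ , S₁-max , v∈S₁) , (S₂ , S₂-max , v∉S₂)) =
    (λ supp → v∉S₂ (support⊆maximum supp S₂ S₂-max)) , (λ core → core∩maximum≡∅ core S₁ S₁-max v∈S₁)
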